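{- For every integer $k \geq 1$, the twincut graph $G_k$ is triangle-free.
   Context: A structured tree is a pair $(T,g)$ where $T$ is a rooted tree and $g$ is a function defined on the internal (non-leaf) nodes $v$ of $T$ such that $g(v)$ is a graph whose vertex set is the set of children of $v$ in $T$. A branch of $T$ is a path in $T$ from the root to a leaf. The realization $R(T,g)$ is the graph with vertex set $V(T)\cup B$, where $B$ is a set of new vertices in bijection with the branches of $T$ (called branch vertices). Its edges are: all pairs $uv$ where $u,v$ are children of a common internal node $z$ and $uv$ is an edge of $g(z)$; and, for each branch vertex $b$, all pairs $bw$ with $w$ a node of $T$ lying on the branch $b$. The edges of $T$ itself are not edges of $R(T,g)$. (If $T$ is a single root vertex, $R(T,g)=K_2$.) The twincut graphs $G_1,G_2,\dots$ are defined inductively: $G_1$ is the one-vertex graph; for $k\ge 2$, $G_k=R(T_k,g_k)$ where $T_k$ is the rooted tree with $k-1$ levels (the root is at level $1$) in which every node $v$ at level $i<k-1$ has exactly $|V(G_{i+1})|$ children and $g_k(v)$ is a copy of $G_{i+1}$ on these children (nodes at level $k-1$ are leaves). -}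

module Defs where

open import Data.Nat using (ℕ; zero; suc; _∸_)
open import Data.Unit using (⊤; tt)
open import Data.Empty using (⊥)
open import Data.Sum using (_⊎_; inj₁; inj₂)
open import Data.Product using (Σ; _×_; _,_; ∃-syntax)
open import Data.List using (List; []; _∷_; _++_; [_]; drop)
open import Relation.Nullary using (¬_)

record Graph : Set₁ where
  field
    V   : Set
    Adj : V → V → Set
open Graph public

TriangleFree : Graph → Set
TriangleFree G = ¬ (∃[ u ] ∃[ v ] ∃[ w ] (Adj G u v × Adj G v w × Adj G u w))

-- Structured trees (T , g): a leaf, or an internal node v carrying a graph
-- g(v) whose vertex set IS the set of children of v (one subtree per vertex).
data STree : Set₁ where
  leaf : STree
  node : (g : Graph) → (V g → STree) → STree

data NodeN (g : Graph) (N : V g → Set) : Set where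
  here  : NodeN g N
  there : (x : V g) → N x → NodeN g N

Node : STree → Set
Node leaf       = ⊤
Node (node g f) = NodeN g (λ x → Node (f x))

rootOf : (t : STree) → Node t
rootOf leaf       = tt
rootOf (node g f) = here

-- Branches (root-to-leaf paths): at each internal node, choose a child.
Branch : STree → Set
Branch leaf       = ⊤
Branch (node g f) = Σ (V g) (λ x → Branch (f x))

-- u and v are children of a common internal node z and uv is an edge of g(z).
data SibN (g : Graph) (N : V g → Set) (r : (x : V g) → N x)
          (S : (x : V g) → N x → N x → Set) : NodeN g N → NodeN g N → Set where
  sib-here  : ∀ {x y} → Adj g x y → SibN g N r S (there x (r x)) (there y (r y))
  sib-there : ∀ {x u v} → S x u v → SibN g N r S (there x u) (there x v)

SibAdj : (t : STree) → Node t → Node t → Set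
SibAdj leaf       _ _ = ⊥
SibAdj (node g f)     = SibN g (λ x → Node (f x)) (λ x → rootOf (f x)) (λ x → SibAdj (f x))

data OnN (g : Graph) (N : V g → Set) (B : V g → Set)
         (O : (x : V g) → N x → B x → Set) : NodeN g N → Σ (V g) B → Set where
  on-root  : ∀ {b} → OnN g N B O here b
  on-child : ∀ {x u b} → O x u b → OnN g N B O (there x u) (x , b)

OnBranch : (t : STree) → Node t → Branch t → Set
OnBranch leaf       _ _ = ⊤
OnBranch (node g f)     = OnN g (λ x → Node (f x)) (λ x → Branch (f x)) (λ x → OnBranch (f x))

data RAdj (t : STree) : Node t ⊎ Branch t → Node t ⊎ Branch t → Set where
  nn : ∀ {u v} → SibAdj t u v → RAdj t (inj₁ u) (inj₁ v)
  nb : ∀ {u b} → OnBranch t u b → RAdj t (inj₁ u) (inj₂ b)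
  bn : ∀ {u b} → OnBranch t u b → RAdj t (inj₂ b) (inj₁ u)

Realization : STree → Graph
Realization t = record { V = Node t ⊎ Branch t ; Adj = RAdj t }

G₁ : Graph
G₁ = record { V = ⊤ ; Adj = λ _ _ → ⊥ }

levelTree : List Graph → STree
levelTree []       = leaf
levelTree (g ∷ gs) = node g (λ _ → levelTree gs)

-- nextG m [G₁,…,G_m] = G_{m+1}
nextG : ℕ → List Graph → Graph
nextG zero    _  = G₁
nextG (suc m) gs = Realization (levelTree (drop 1 gs))

twincutList : ℕ → List Graph
twincutList zero    = []
twincutList (suc m) = twincutList m ++ [ nextG m (twincutList m) ]

-- twincut k = G_k  (for k ≥ 1; twincut 0 is junk = G₁)
twincut : ℕ → Graph
twincut k = nextG (k ∸ 1) (twincutList (k ∸ 1))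

-- A triangle of a realization R(T,g) contains at most one branch vertex,
-- since branch vertices are pairwise non-adjacent. With none, it is a
-- triangle of sibling edges; these join children of a common parent, so it
-- lies inside a single g(z). With one, its two tree nodes are adjacent
-- children of a common z lying on one branch, hence the same child x, and
-- the loop at x is a degenerate triangle x x x of g(z). So R(T,g) is
-- triangle-free as soon as every g(z) is, and induction on k applies to the
-- twincut graphs.
module Submission where

open import Defs
open import Data.Nat using (ℕ; _≤_; zero; suc)
open import Data.Unit using (⊤; tt)
open import Data.Empty using (⊥)
open import Data.Product using (_×_; _,_)
open import Data.List.Relation.Unary.All using (All; []; _∷_)
open import Data.List.Relation.Unary.All.Properties using (++⁺; drop⁺)
open import Relation.Nullary using (¬_)

TriangleFreeLabels : STree → Set
TriangleFreeLabels leaf       = ⊤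
TriangleFreeLabels (node g f) = TriangleFree g × (∀ x → TriangleFreeLabels (f x))

SiblingGraph : STree → Graph
SiblingGraph t = record { V = Node t ; Adj = SibAdj t }

¬SibAdj-rootˡ : ∀ t {v} → ¬ SibAdj t (rootOf t) v
¬SibAdj-rootˡ leaf       ()
¬SibAdj-rootˡ (node g f) ()

¬SibAdj-rootʳ : ∀ t {u} → ¬ SibAdj t u (rootOf t)
¬SibAdj-rootʳ leaf       ()
¬SibAdj-rootʳ (node g f) ()

siblingGraph-triangleFree : ∀ t → TriangleFreeLabels t → TriangleFree (SiblingGraph t)
siblingGraph-triangleFree leaf       _          (_ , _ , _ , () , _)
siblingGraph-triangleFree (node g f) (tf , tfs) (_ , _ , _ , uv , vw , uw) = triangle uv vw uw
  where
  triangle : ∀ {u v w} → SibAdj (node g f) u v → SibAdj (node g f) v w →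
             SibAdj (node g f) u w → ⊥
  triangle (sib-here p)  (sib-here q)  (sib-here r)  = tf (_ , _ , _ , p , q , r)
  triangle (sib-here _)  (sib-here _)  (sib-there r) = ¬SibAdj-rootˡ (f _) r
  triangle (sib-here _)  (sib-there q) _             = ¬SibAdj-rootˡ (f _) q
  triangle (sib-there p) (sib-here _)  _             = ¬SibAdj-rootʳ (f _) p
  triangle (sib-there p) (sib-there _) (sib-here _)  = ¬SibAdj-rootˡ (f _) p
  triangle (sib-there p) (sib-there q) (sib-there r) =
    siblingGraph-triangleFree (f _) (tfs _) (_ , _ , _ , p , q , r)

¬SibAdj-onBranch : ∀ t → TriangleFreeLabels t → ∀ {u v b} →
                   SibAdj t u v → OnBranch t u b → ¬ OnBranch t v b
¬SibAdj-onBranch leaf       _          ()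
¬SibAdj-onBranch (node g f) (tf , _)   (sib-here p)  (on-child _) (on-child _) =
  tf (_ , _ , _ , p , p , p)
¬SibAdj-onBranch (node g f) (_ , tfs)  (sib-there s) (on-child o) (on-child o′) =
  ¬SibAdj-onBranch (f _) (tfs _) s o o′

realization-triangleFree : ∀ t → TriangleFreeLabels t → TriangleFree (Realization t)
realization-triangleFree t tf (_ , _ , _ , nn uv , nn vw , nn uw) =
  siblingGraph-triangleFree t tf (_ , _ , _ , uv , vw , uw)
realization-triangleFree t tf (_ , _ , _ , nn uv , nb vb , nb ub) = ¬SibAdj-onBranch t tf uv ub vb
realization-triangleFree t tf (_ , _ , _ , nb ub , bn vb , nn uv) = ¬SibAdj-onBranch t tf uv ub vb
realization-triangleFree t tf (_ , _ , _ , bn ub , nn uv , bn vb) = ¬SibAdj-onBranch t tf uv ub vb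

levelTree-triangleFreeLabels : ∀ {gs} → All TriangleFree gs → TriangleFreeLabels (levelTree gs)
levelTree-triangleFreeLabels []       = tt
levelTree-triangleFreeLabels (p ∷ ps) = p , λ _ → levelTree-triangleFreeLabels ps

G₁-triangleFree : TriangleFree G₁
G₁-triangleFree (_ , _ , _ , () , _)

nextG-triangleFree : ∀ m {gs} → All TriangleFree gs → TriangleFree (nextG m gs)
nextG-triangleFree zero    _  = G₁-triangleFree
nextG-triangleFree (suc m) ps =
  realization-triangleFree _ (levelTree-triangleFreeLabels (drop⁺ 1 ps))

twincutList-triangleFree : ∀ m → All TriangleFree (twincutList m)
twincutList-triangleFree zero    = []
twincutList-triangleFree (suc m) = ++⁺ ps (nextG-triangleFree m ps ∷ [])
  where ps = twincutList-triangleFree m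

proposition1 : ∀ (k : ℕ) → 1 ≤ k → TriangleFree (twincut k)
proposition1 (suc k) _ = nextG-triangleFree k (twincutList-triangleFree k)
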